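{- If $T$ is a tree, then ${\rm gpack}(T) = {\rm gpack}({\rm SM}(T))$.
   Context: Smoothing a vertex $u$ of degree $2$ with neighbours $x,y$ means deleting $u$ and adding the edge $xy$; ${\rm SM}(G)$ denotes the graph obtained from $G$ by smoothing all vertices of degree $2$ (well defined up to isomorphism). A geodesic is a shortest path; it is maximal if it is not contained as a subpath in any other geodesic. A geodesic packing is a set of pairwise vertex-disjoint maximal geodesics, and ${\rm gpack}(G)$ is its maximum cardinality. -}

module Defs where

open import Data.Nat using (ℕ; suc; _≤_)
open import Data.Fin using (Fin; punchIn)
open import Data.List using (List; []; _∷_; length; head; last; _++_)
open import Data.Maybe using (just)
open import Data.List.Relation.Unary.Linked using (Linked)
open import Data.List.Relation.Unary.All using (All)
open import Data.List.Relation.Unary.AllPairs using (AllPairs)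
open import Data.List.Relation.Unary.Unique.Propositional using (Unique)
open import Data.List.Membership.Propositional using (_∈_; _∉_)
open import Data.Product using (Σ; ∃; ∃₂; _×_; _,_)
open import Data.Sum using (_⊎_)
open import Data.Empty using (⊥)
open import Relation.Nullary using (¬_)
open import Relation.Binary.PropositionalEquality using (_≡_; _≢_)
open import Function.Bundles using (_⇔_; _↔_; Inverse)

record Graph (n : ℕ) : Set₁ where
  field
    Adj   : Fin n → Fin n → Set
    sym   : ∀ {x y} → Adj x y → Adj y x
    irrefl : ∀ {x} → ¬ Adj x x
open Graph public

module _ {n : ℕ} (G : Graph n) where

  IsPath : List (Fin n) → Set
  IsPath P = Linked (Adj G) P × Unique P × P ≢ []

  PathBetween : Fin n → Fin n → List (Fin n) → Set
  PathBetween u v P = IsPath P × head P ≡ just u × last P ≡ just v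

  Connected : Set
  Connected = ∀ u v → ∃ λ P → PathBetween u v P

  IsCycle : List (Fin n) → Set
  IsCycle C = IsPath C × 3 ≤ length C
            × ∃₂ λ u v → head C ≡ just u × last C ≡ just v × Adj G v u

  Acyclic : Set
  Acyclic = ∀ C → ¬ IsCycle C

  IsTree : Set
  IsTree = Connected × Acyclic

  IsGeodesic : List (Fin n) → Set
  IsGeodesic P = IsPath P ×
    (∀ Q → IsPath Q → head Q ≡ head P → last Q ≡ last P → length P ≤ length Q)

  SubpathOf : List (Fin n) → List (Fin n) → Set
  SubpathOf P Q = ∃₂ λ as bs → Q ≡ as ++ (P ++ bs)

  IsMaxGeodesic : List (Fin n) → Set
  IsMaxGeodesic P = IsGeodesic P ×
    (∀ Q → IsGeodesic Q → SubpathOf P Q → length Q ≡ length P)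

  Disjoint : List (Fin n) → List (Fin n) → Set
  Disjoint P Q = ∀ x → x ∈ P → x ∉ Q

  IsPacking : List (List (Fin n)) → Set
  IsPacking ps = All IsMaxGeodesic ps × AllPairs Disjoint ps

  IsGpack : ℕ → Set
  IsGpack k = (∃ λ ps → IsPacking ps × length ps ≡ k)
            × (∀ ps → IsPacking ps → length ps ≤ k)

  Degree2With : Fin n → Fin n → Fin n → Set
  Degree2With u x y = x ≢ y × Adj G u x × Adj G u y
                    × (∀ z → Adj G u z → z ≡ x ⊎ z ≡ y)

  HasDegree2 : Fin n → Set
  HasDegree2 u = ∃₂ λ x y → Degree2With u x y

-- Vertices of H are identified with the vertices of G other than u via punchIn u.
SmoothStep : ∀ {n} → Graph (suc n) → Graph n → Set
SmoothStep {n} G H = Σ (Fin (suc n)) λ u → ∃₂ λ x y → Degree2With G u x y ×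
  (∀ a b → Adj H a b ⇔
      (Adj G (punchIn u a) (punchIn u b)
       ⊎ (punchIn u a ≡ x × punchIn u b ≡ y)
       ⊎ (punchIn u a ≡ y × punchIn u b ≡ x)))

data Smoothings : ∀ {n m} → Graph n → Graph m → Set₁ where
  done : ∀ {n} (G : Graph n) → Smoothings G G
  step : ∀ {n m} {G : Graph (suc n)} {H : Graph n} {K : Graph m} →
         SmoothStep G H → Smoothings H K → Smoothings G K

Iso : ∀ {n m} → Graph n → Graph m → Set
Iso {n} {m} G H = Σ (Fin n ↔ Fin m) λ f →
  ∀ a b → Adj G a b ⇔ Adj H (Inverse.to f a) (Inverse.to f b)

IsSM : ∀ {n m} → Graph n → Graph m → Set₁
IsSM {n} {m} G S = ∃ λ k → Σ (Graph k) λ H →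
  Smoothings G H × (∀ u → ¬ HasDegree2 H u) × Iso H S

module Submission where

-- In an acyclic graph any two vertices are joined by exactly one path, so every path is a
-- geodesic and the maximal geodesics are exactly the paths that cannot be extended at either
-- end. Smoothing a vertex u of degree 2 with neighbours x, y keeps paths unique; deleting u from
-- a path of G, and re-inserting u between consecutive x and y in a path of the smoothed graph H,
-- both map non-extendable paths to non-extendable paths and vertex-disjoint paths to disjoint
-- ones (two re-insertions can share u only if both paths contain x). So packings of G and H
-- correspond size for size, along every smoothing step and across the final isomorphism.

open import Defs renaming (sym to adj-sym; irrefl to adj-irrefl)
open import Data.Nat using (ℕ; suc; _≤_; z≤n; s≤s)
open import Data.Nat.Properties using (≤-reflexive; ≤-trans; +-comm; 1+n≢n)
open import Data.Fin using (Fin; punchIn; punchOut)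
open import Data.Fin.Properties
  using (punchIn-injective; punchInᵢ≢i; punchOut-cong; punchIn-punchOut; punchOut-punchIn)
  renaming (_≟_ to _≟F_)
open import Data.List using (List; []; _∷_; length; head; last; _++_; _∷ʳ_; map)
open import Data.List.Properties
  using ( ∷-injectiveʳ; ∷-injectiveˡ; ++-identityʳ; ++-assoc; ∷ʳ-injective; length-++; length-map
        ; map-++; map-∘; map-id-local; head-map; last-map)
open import Data.Maybe as Maybe using (just)
open import Data.Maybe.Properties using (just-injective)
import Data.Maybe.Relation.Binary.Connected as MaybeConnected
open import Data.List.Relation.Unary.Linked using (Linked; []; [-]; _∷_)
import Data.List.Relation.Unary.Linked as Linked
import Data.List.Relation.Unary.Linked.Properties as Linked
open import Data.List.Relation.Unary.All using (All; []; _∷_; lookup; tabulate)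
import Data.List.Relation.Unary.All as All
import Data.List.Relation.Unary.All.Properties as All
open import Data.List.Relation.Unary.AllPairs using (AllPairs; []; _∷_)
import Data.List.Relation.Unary.AllPairs as AllPairs
import Data.List.Relation.Unary.AllPairs.Properties as AllPairs
open import Data.List.Relation.Unary.Unique.Propositional using (Unique)
open import Data.List.Relation.Unary.Unique.Propositional.Properties using (Unique[x∷xs]⇒x∉xs)
  renaming (map⁺ to unique-map⁺)
open import Data.List.Relation.Unary.Any using (here; there)
open import Data.List.Membership.Propositional using (_∈_; _∉_)
open import Data.List.Membership.Propositional.Properties using (∈-∃++; ∈-++⁺ˡ; ∈-map⁻)
open import Data.Product using (∃; _×_; _,_; proj₁; proj₂)
open import Data.Sum using (_⊎_; inj₁; inj₂; map₂)
open import Data.Empty using (⊥; ⊥-elim)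
open import Relation.Nullary using (yes; no; Dec)
open import Relation.Nullary.Decidable using (_×-dec_; _⊎-dec_)
open import Relation.Binary.PropositionalEquality
  using (_≡_; _≢_; refl; sym; trans; cong; subst; subst₂; module ≡-Reasoning)
open import Function using (_∘_)
open import Function.Bundles using (_⇔_; mk⇔; Inverse; Equivalence)

private variable
  A : Set
  v z : A

last-∷ʳ : (xs : List A) (v : A) → last (xs ∷ʳ v) ≡ just v
last-∷ʳ []           v = refl
last-∷ʳ (a ∷ [])     v = refl
last-∷ʳ (a ∷ b ∷ xs) v = last-∷ʳ (b ∷ xs) v

last≡just⇒∷ʳ : (xs : List A) → last xs ≡ just v → ∃ λ ys → xs ≡ ys ∷ʳ v
last≡just⇒∷ʳ (a ∷ [])     refl = [] , refl
last≡just⇒∷ʳ (a ∷ b ∷ xs) eq   with ys , e ← last≡just⇒∷ʳ (b ∷ xs) eq = a ∷ ys , cong (a ∷_) e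

last-++-∷ : (xs : List A) (y : A) (ys : List A) → last (xs ++ y ∷ ys) ≡ last (y ∷ ys)
last-++-∷ []           y ys = refl
last-++-∷ (a ∷ [])     y ys = refl
last-++-∷ (a ∷ b ∷ xs) y ys = last-++-∷ (b ∷ xs) y ys

last-∷ : (a : A) (xs : List A) → xs ≢ [] → last (a ∷ xs) ≡ last xs
last-∷ a []       xs≢[] = ⊥-elim (xs≢[] refl)
last-∷ a (b ∷ xs) _     = refl

last⇒∈ : (xs : List A) → last xs ≡ just v → v ∈ xs
last⇒∈ (a ∷ [])     refl = here refl
last⇒∈ (a ∷ b ∷ xs) eq   = there (last⇒∈ (b ∷ xs) eq)

∃last : (xs : List A) → xs ≢ [] → ∃ λ v → last xs ≡ just v
∃last []           xs≢[] = ⊥-elim (xs≢[] refl)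
∃last (a ∷ [])     _     = a , refl
∃last (a ∷ b ∷ xs) _     = ∃last (b ∷ xs) (λ ())

++-∷≢[] : (xs : List A) (y : A) (ys : List A) → xs ++ y ∷ ys ≢ []
++-∷≢[] []       y ys ()
++-∷≢[] (x ∷ xs) y ys ()

length-∷ʳ : (xs : List A) (z : A) → length (xs ∷ʳ z) ≡ suc (length xs)
length-∷ʳ xs z = trans (length-++ xs) (+-comm (length xs) 1)

∷ʳ-∷ʳ-injectiveʳ : (xs ys : List A) {a b c d : A} → xs ++ a ∷ c ∷ [] ≡ ys ++ b ∷ d ∷ [] → a ≡ b
∷ʳ-∷ʳ-injectiveʳ xs ys {a} {b} {c} {d} eq =
  proj₂ (∷ʳ-injective xs ys (proj₁ (∷ʳ-injective (xs ∷ʳ a) (ys ∷ʳ b)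
    (trans (++-assoc xs (a ∷ []) (c ∷ [])) (trans eq (sym (++-assoc ys (b ∷ []) (d ∷ []))))))))

module _ {R : A → A → Set} where

  linked-prefix : (xs : List A) {y : A} {ys : List A} → Linked R (xs ++ y ∷ ys) → Linked R (xs ∷ʳ y)
  linked-prefix []           l       = [-]
  linked-prefix (a ∷ [])     (r ∷ l) = r ∷ [-]
  linked-prefix (a ∷ b ∷ xs) (r ∷ l) = r ∷ linked-prefix (b ∷ xs) l

  linked-suffix : (xs : List A) {ys : List A} → Linked R (xs ++ ys) → Linked R ys
  linked-suffix []       l = l
  linked-suffix (a ∷ xs) l = linked-suffix xs (Linked.tail l)

  linked-junction : (xs : List A) {y : A} {ys : List A} →
                    Linked R (xs ++ y ∷ ys) → last xs ≡ just v → R v y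
  linked-junction (a ∷ [])     (r ∷ l) refl = r
  linked-junction (a ∷ b ∷ xs) (r ∷ l) eq   = linked-junction (b ∷ xs) l eq

  linked-∷ʳ⁺ : {xs : List A} → Linked R xs → last xs ≡ just v → R v z → Linked R (xs ∷ʳ z)
  linked-∷ʳ⁺ {v = v} {z} l eq r =
    Linked.++⁺ l (subst (λ m → MaybeConnected.Connected R m (just z)) (sym eq) (MaybeConnected.just r)) [-]

unique-prefix : (xs : List A) {y : A} {ys : List A} → Unique (xs ++ y ∷ ys) → Unique (xs ∷ʳ y)
unique-prefix []       (_ ∷ _)  = [] ∷ []
unique-prefix (a ∷ xs) (h ∷ un) =
  All.∷ʳ⁺ (All.++⁻ˡ xs h) (All.head (All.++⁻ʳ xs h)) ∷ unique-prefix xs un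

unique-suffix : (xs : List A) {ys : List A} → Unique (xs ++ ys) → Unique ys
unique-suffix []       un       = un
unique-suffix (a ∷ xs) (_ ∷ un) = unique-suffix xs un

unique-∷ʳ⁺ : (xs : List A) → Unique xs → z ∉ xs → Unique (xs ∷ʳ z)
unique-∷ʳ⁺ []       _        _   = [] ∷ []
unique-∷ʳ⁺ (a ∷ xs) (h ∷ un) z∉ = All.∷ʳ⁺ h (λ e → z∉ (here (sym e))) ∷ unique-∷ʳ⁺ xs un (z∉ ∘ there)

unique-++⇒∉ : (xs : List A) {ys : List A} → Unique (xs ++ ys) → v ∈ xs → v ∉ ys
unique-++⇒∉ (a ∷ xs) (h ∷ un) (here refl) v∈ys = lookup (All.++⁻ʳ xs h) v∈ys refl
unique-++⇒∉ (a ∷ xs) (h ∷ un) (there v∈xs)     = unique-++⇒∉ xs un v∈xs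

module _ {n : ℕ} (G : Graph n) where

  edge-path : ∀ {a b} → Adj G a b → IsPath G (a ∷ b ∷ [])
  edge-path {a} r = r ∷ [-] , ((λ e → adj-irrefl G (subst (Adj G a) (sym e) r)) ∷ []) ∷ [] ∷ [] , (λ ())

  ∷-path : ∀ P {a z} → head P ≡ just a → IsPath G P → Adj G a z → z ∉ P → IsPath G (z ∷ P)
  ∷-path (a ∷ P) refl (l , un , _) r z∉ = adj-sym G r ∷ l , All.¬Any⇒All¬ (a ∷ P) z∉ ∷ un , (λ ())

  ∷ʳ-path : ∀ P {a z} → last P ≡ just a → IsPath G P → Adj G a z → z ∉ P → IsPath G (P ∷ʳ z)
  ∷ʳ-path P eq (l , un , _) r z∉ = linked-∷ʳ⁺ l eq r , unique-∷ʳ⁺ P un z∉ , ++-∷≢[] P _ []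

  UniquePaths : Set
  UniquePaths = ∀ P Q → IsPath G P → IsPath G Q → head P ≡ head Q → last P ≡ last Q → P ≡ Q

  acyclic⇒uniquePaths : Acyclic G → UniquePaths
  acyclic⇒uniquePaths _       []       _ (_ , _ , []≢[]) _ _ _ = ⊥-elim ([]≢[] refl)
  acyclic⇒uniquePaths _       (a ∷ ps) [] _ (_ , _ , []≢[]) _ _ = ⊥-elim ([]≢[] refl)
  acyclic⇒uniquePaths acyclic (a ∷ ps) (.a ∷ qs) (lp , up , _) (lq , uq , _) refl same-last =
    cong (a ∷_) (common-start a ps qs lp up lq uq same-last)
    where
    open import Data.List.Membership.DecPropositional (_≟F_ {n}) using (_∈?_)

    cycle : ∀ {b} a c qs qs′ → Linked (Adj G) (a ∷ c ∷ qs ++ b ∷ qs′) → Unique (a ∷ c ∷ qs ++ b ∷ qs′) →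
            Adj G a b → ⊥
    cycle {b} a c qs qs′ l un r = acyclic (a ∷ c ∷ qs ∷ʳ b)
      ( (linked-prefix (a ∷ c ∷ qs) l , unique-prefix (a ∷ c ∷ qs) un , (λ ()))
      , s≤s (s≤s (subst (1 ≤_) (sym (length-∷ʳ qs b)) (s≤s z≤n)))
      , a , b , refl , last-∷ʳ (a ∷ c ∷ qs) b , adj-sym G r)

    -- Either the second path meets b later, closing a cycle with the edge ab, or it can be
    -- extended backwards by b, and the first path shortens by one vertex.
    fork⇒⊥ : ∀ a b rest qs → Linked (Adj G) (a ∷ b ∷ rest) → Unique (a ∷ b ∷ rest) →
             Linked (Adj G) (a ∷ qs) → Unique (a ∷ qs) → qs ≢ [] → head qs ≢ just b →
             last (b ∷ rest) ≡ last qs → ⊥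
    fork⇒⊥ a b rest qs lp up lq uq qs≢[] head≢b same-last with b ∈? qs
    fork⇒⊥ a b rest qs lp up lq uq qs≢[] head≢b same-last | yes b∈qs with ∈-∃++ b∈qs
    ... | []       , qs′ , refl = head≢b refl
    ... | c ∷ qs₁ , qs′ , refl = cycle a c qs₁ qs′ lq uq (Linked.head lp)
    fork⇒⊥ a b [] qs lp up lq uq qs≢[] head≢b same-last | no b∉qs =
      b∉qs (last⇒∈ qs (sym same-last))
    fork⇒⊥ a b (c ∷ rest) qs lp (a∉ ∷ up) lq uq qs≢[] head≢b same-last | no b∉qs =
      fork⇒⊥ b c rest (a ∷ qs) (Linked.tail lp) up (adj-sym G (Linked.head lp) ∷ lq)
        (((λ b≡a → lookup a∉ (here refl) (sym b≡a)) ∷ All.¬Any⇒All¬ qs b∉qs) ∷ uq) (λ ())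
        (λ a≡c → lookup a∉ (there (here refl)) (just-injective a≡c))
        (trans same-last (sym (last-∷ a qs qs≢[])))

    common-start : ∀ a ps qs → Linked (Adj G) (a ∷ ps) → Unique (a ∷ ps) →
                   Linked (Adj G) (a ∷ qs) → Unique (a ∷ qs) → last (a ∷ ps) ≡ last (a ∷ qs) → ps ≡ qs
    common-start a []       []       _  _  _  _  _ = refl
    common-start a []       (q ∷ qs) _  _  _  uq e = ⊥-elim (Unique[x∷xs]⇒x∉xs uq (last⇒∈ (q ∷ qs) (sym e)))
    common-start a (p ∷ ps) []       _  up _  _  e = ⊥-elim (Unique[x∷xs]⇒x∉xs up (last⇒∈ (p ∷ ps) e))
    common-start a (p ∷ ps) (q ∷ qs) lp up lq uq e with p ≟F q
    ... | yes refl = cong (p ∷_) (common-start p ps qs (Linked.tail lp) (AllPairs.tail up)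
                                               (Linked.tail lq) (AllPairs.tail uq) e)
    ... | no p≢q = ⊥-elim (fork⇒⊥ a p ps (q ∷ qs) lp up lq uq (λ ()) (p≢q ∘ sym ∘ just-injective) e)

NonExtendable : ∀ {n} → Graph n → List (Fin n) → Set
NonExtendable G P = IsPath G P × (∀ a z → head P ≡ just a → Adj G a z → z ∈ P)
                               × (∀ a z → last P ≡ just a → Adj G a z → z ∈ P)

module WithUniquePaths {n : ℕ} (G : Graph n) (uniq : UniquePaths G) where
  open import Data.List.Membership.DecPropositional (_≟F_ {n}) using (_∈?_)

  path⇒geodesic : ∀ P → IsPath G P → IsGeodesic G P
  path⇒geodesic P p = p , λ Q q same-head same-last →
    ≤-reflexive (cong length (uniq P Q p q (sym same-head) (sym same-last)))

  -- Otherwise the segment from h to z and the edge hz would be two distinct h–z paths.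
  adj-head⇒second : ∀ h r z → IsPath G (h ∷ r) → z ∈ h ∷ r → Adj G h z → ∃ λ rest → r ≡ z ∷ rest
  adj-head⇒second h r z _            (here refl)  hz = ⊥-elim (adj-irrefl G hz)
  adj-head⇒second h r z (l , un , _) (there z∈r) hz with ∈-∃++ z∈r
  ... | []      , rest , refl = rest , refl
  ... | p ∷ pre , rest , refl = ⊥-elim (++-∷≢[] pre z [] (∷-injectiveʳ (∷-injectiveʳ
        (uniq (h ∷ p ∷ pre ∷ʳ z) (h ∷ z ∷ [])
              (linked-prefix (h ∷ p ∷ pre) l , unique-prefix (h ∷ p ∷ pre) un , (λ ()))
              (edge-path G hz) refl (last-∷ʳ (h ∷ p ∷ pre) z)))))

  adj-last⇒penultimate : ∀ P h z → IsPath G P → last P ≡ just h → z ∈ P → Adj G h z →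
                         ∃ λ pre → P ≡ pre ++ z ∷ h ∷ []
  adj-last⇒penultimate P h z (l , un , _) last≡h z∈P hz with ∈-∃++ z∈P
  ... | pre , rest , refl = pre , cong (pre ++_) rest≡
    where
    rest≡ : z ∷ rest ≡ z ∷ h ∷ []
    rest≡ = uniq (z ∷ rest) (z ∷ h ∷ []) (linked-suffix pre l , unique-suffix pre un , (λ ()))
                 (edge-path G (adj-sym G hz)) refl (trans (sym (last-++-∷ pre z rest)) last≡h)

  nonExtendable⇒maxGeodesic : ∀ P → NonExtendable G P → IsMaxGeodesic G P
  nonExtendable⇒maxGeodesic []      ((_ , _ , []≢[]) , _) = ⊥-elim ([]≢[] refl)
  nonExtendable⇒maxGeodesic (p ∷ P) (path , head-closed , last-closed) =
    path⇒geodesic (p ∷ P) path , maximal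
    where
    only-trivial-extension : ∀ as bs → Linked (Adj G) (as ++ (p ∷ P) ++ bs) → Unique (as ++ (p ∷ P) ++ bs) →
                             length (as ++ (p ∷ P) ++ bs) ≡ length (p ∷ P)
    only-trivial-extension [] [] _ _ = cong length (++-identityʳ (p ∷ P))
    only-trivial-extension [] (b ∷ bs) l un with w , last≡w ← ∃last (p ∷ P) (λ ()) =
      ⊥-elim (unique-++⇒∉ (p ∷ P) un (last-closed w b last≡w (linked-junction (p ∷ P) l last≡w)) (here refl))
    only-trivial-extension (a ∷ as) bs l un with w , last≡w ← ∃last (a ∷ as) (λ ()) =
      ⊥-elim (unique-++⇒∉ (a ∷ as) un (last⇒∈ (a ∷ as) last≡w)
               (∈-++⁺ˡ (head-closed p w refl (adj-sym G (linked-junction (a ∷ as) l last≡w)))))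

    maximal : ∀ Q → IsGeodesic G Q → SubpathOf G (p ∷ P) Q → length Q ≡ length (p ∷ P)
    maximal _ ((l , un , _) , _) (as , bs , refl) = only-trivial-extension as bs l un

  maxGeodesic⇒nonExtendable : ∀ P → IsMaxGeodesic G P → NonExtendable G P
  maxGeodesic⇒nonExtendable P ((path , _) , maximal) = path , head-closed , last-closed
    where
    head-closed : ∀ a z → head P ≡ just a → Adj G a z → z ∈ P
    head-closed a z head≡a az with z ∈? P
    ... | yes z∈P = z∈P
    ... | no z∉P = ⊥-elim (1+n≢n (maximal (z ∷ P) (path⇒geodesic (z ∷ P) (∷-path G P head≡a path az z∉P))
                                          (z ∷ [] , [] , cong (z ∷_) (sym (++-identityʳ P)))))

    last-closed : ∀ a z → last P ≡ just a → Adj G a z → z ∈ P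
    last-closed a z last≡a az with z ∈? P
    ... | yes z∈P = z∈P
    ... | no z∉P = ⊥-elim (1+n≢n (trans (sym (length-∷ʳ P z))
                     (maximal (P ∷ʳ z) (path⇒geodesic (P ∷ʳ z) (∷ʳ-path G P last≡a path az z∉P)) ([] , z ∷ [] , refl))))

PackingTransfer : ∀ {n m} → Graph n → Graph m → Set
PackingTransfer G S = ∀ ps → IsPacking G ps → ∃ λ qs → IsPacking S qs × length qs ≡ length ps

PackingEquivalent : ∀ {n m} → Graph n → Graph m → Set
PackingEquivalent G S = PackingTransfer G S × PackingTransfer S G

transfer-trans : ∀ {n m k} {G : Graph n} {H : Graph m} {K : Graph k} →
                 PackingTransfer G H → PackingTransfer H K → PackingTransfer G K
transfer-trans G→H H→K ps packing =
  let qs , packing′ , len≡  = G→H ps packing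
      rs , packing″ , len≡′ = H→K qs packing′
  in rs , packing″ , trans len≡′ len≡

packingEquivalent-refl : ∀ {n} {G : Graph n} → PackingEquivalent G G
packingEquivalent-refl = (λ ps packing → ps , packing , refl) , (λ ps packing → ps , packing , refl)

packingEquivalent-trans : ∀ {n m k} {G : Graph n} {H : Graph m} {K : Graph k} →
                          PackingEquivalent G H → PackingEquivalent H K → PackingEquivalent G K
packingEquivalent-trans {G = G} {H} {K} (G→H , H→G) (H→K , K→H) =
  transfer-trans {G = G} {H} {K} G→H H→K , transfer-trans {G = K} {H} {G} K→H H→G

gpack-transfer : ∀ {n m} (G : Graph n) (S : Graph m) → PackingTransfer G S → PackingTransfer S G →
                 ∀ k → IsGpack G k → IsGpack S k
gpack-transfer G S G→S S→G k ((ps , packing , len≡k) , bound) =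
  let qs , packing′ , len≡ = G→S ps packing
  in (qs , packing′ , trans len≡ len≡k) , λ rs packing″ →
       let ps′ , packing‴ , len≡′ = S→G rs packing″
       in ≤-trans (≤-reflexive (sym len≡′)) (bound ps′ packing‴)

packingEquivalent⇒gpack-⇔ : ∀ {n m} (G : Graph n) (S : Graph m) → PackingEquivalent G S →
                            ∀ k → IsGpack G k ⇔ IsGpack S k
packingEquivalent⇒gpack-⇔ G S (G→S , S→G) k =
  mk⇔ (gpack-transfer G S G→S S→G k) (gpack-transfer S G S→G G→S k)

map-transfer : ∀ {n m} (G : Graph n) (S : Graph m) (f : List (Fin n) → List (Fin m)) →
               (∀ P → IsMaxGeodesic G P → IsMaxGeodesic S (f P)) →
               (∀ P Q → Disjoint G P Q → Disjoint S (f P) (f Q)) → PackingTransfer G S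
map-transfer G S f f-max f-disjoint ps (maxs , disjoint) =
  map f ps , (All.map⁺ (All.map (f-max _) maxs) , AllPairs.map⁺ (AllPairs.map (f-disjoint _ _) disjoint)) ,
  length-map f ps

record GraphIso {n m : ℕ} (G : Graph n) (S : Graph m) : Set where
  field
    to       : Fin n → Fin m
    from     : Fin m → Fin n
    from∘to  : ∀ a → from (to a) ≡ a
    to∘from  : ∀ b → to (from b) ≡ b
    to-adj   : ∀ {a b} → Adj G a b → Adj S (to a) (to b)
    from-adj : ∀ {a b} → Adj S a b → Adj G (from a) (from b)

graphIso-sym : ∀ {n m} {G : Graph n} {S : Graph m} → GraphIso G S → GraphIso S G
graphIso-sym ι = record { to = from ; from = to ; from∘to = to∘from ; to∘from = from∘to
                        ; to-adj = from-adj ; from-adj = to-adj }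
  where open GraphIso ι

Iso⇒GraphIso : ∀ {n m} {G : Graph n} {S : Graph m} → Iso G S → GraphIso G S
Iso⇒GraphIso {S = S} (f , adj⇔) = record
  { to = to ; from = from ; from∘to = strictlyInverseʳ ; to∘from = strictlyInverseˡ
  ; to-adj = λ {a} {b} → Equivalence.to (adj⇔ a b)
  ; from-adj = λ {a} {b} r → Equivalence.from (adj⇔ (from a) (from b))
                 (subst₂ (Adj S) (sym (strictlyInverseˡ a)) (sym (strictlyInverseˡ b)) r) }
  where open Inverse f

module _ {n m : ℕ} {G : Graph n} {S : Graph m} (ι : GraphIso G S) where
  open GraphIso ι

  to-injective : ∀ {a b} → to a ≡ to b → a ≡ b
  to-injective {a} {b} e = trans (sym (from∘to a)) (trans (cong from e) (from∘to b))

  map-from∘to : ∀ P → map from (map to P) ≡ P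
  map-from∘to P = trans (sym (map-∘ P)) (map-id-local (tabulate (λ {a} _ → from∘to a)))

  isPath-map : ∀ {P} → IsPath G P → IsPath S (map to P)
  isPath-map {a ∷ P} (l , un , _) = Linked.map⁺ (Linked.map to-adj l) , unique-map⁺ to-injective un , (λ ())
  isPath-map {[]}    (_ , _ , []≢[]) = ⊥-elim ([]≢[] refl)

  map-from-end : (end : ∀ {X : Set} → List X → Maybe.Maybe X) →
                 (∀ {X Y : Set} (f : X → Y) xs → end (map f xs) ≡ Maybe.map f (end xs)) →
                 ∀ P Q → end Q ≡ end (map to P) → end (map from Q) ≡ end P
  map-from-end end end-map P Q e = begin
    end (map from Q)                 ≡⟨ end-map from Q ⟩
    Maybe.map from (end Q)           ≡⟨ cong (Maybe.map from) e ⟩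
    Maybe.map from (end (map to P))  ≡⟨ end-map from (map to P) ⟨
    end (map from (map to P))        ≡⟨ cong end (map-from∘to P) ⟩
    end P                            ∎
    where open ≡-Reasoning

module _ {n m : ℕ} {G : Graph n} {S : Graph m} (ι : GraphIso G S) where
  open GraphIso ι

  isGeodesic-map : ∀ P → IsGeodesic G P → IsGeodesic S (map to P)
  isGeodesic-map P (path , shortest) = isPath-map ι path , λ Q q same-head same-last →
    subst₂ _≤_ (sym (length-map to P)) (length-map from Q)
      (shortest (map from Q) (isPath-map (graphIso-sym ι) q)
        (map-from-end ι head (λ f → head-map {f = f}) P Q same-head)
        (map-from-end ι last last-map P Q same-last))

module _ {n m : ℕ} {G : Graph n} {S : Graph m} (ι : GraphIso G S) where
  open GraphIso ι

  isMaxGeodesic-map : ∀ P → IsMaxGeodesic G P → IsMaxGeodesic S (map to P)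
  isMaxGeodesic-map P (geodesic , maximal) = isGeodesic-map ι P geodesic , λ Q geodesicQ (as , bs , Q≡) →
    begin
      length Q                ≡⟨ length-map from Q ⟨
      length (map from Q)     ≡⟨ maximal (map from Q) (isGeodesic-map (graphIso-sym ι) Q geodesicQ)
                                         (map from as , map from bs , map-from-split as bs Q≡) ⟩
      length P                ≡⟨ length-map to P ⟨
      length (map to P)       ∎
    where
    open ≡-Reasoning
    map-from-split : ∀ as bs {Q} → Q ≡ as ++ (map to P ++ bs) → map from Q ≡ map from as ++ (P ++ map from bs)
    map-from-split as bs refl = begin
      map from (as ++ (map to P ++ bs))                  ≡⟨ map-++ from as (map to P ++ bs) ⟩
      map from as ++ map from (map to P ++ bs)           ≡⟨ cong (map from as ++_) (map-++ from (map to P) bs) ⟩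
      map from as ++ (map from (map to P) ++ map from bs)
        ≡⟨ cong (λ R → map from as ++ (R ++ map from bs)) (map-from∘to ι P) ⟩
      map from as ++ (P ++ map from bs)                  ∎

  disjoint-map : ∀ P Q → Disjoint G P Q → Disjoint S (map to P) (map to Q)
  disjoint-map P Q disjoint v v∈P v∈Q
    with a , a∈P , refl ← ∈-map⁻ to v∈P | b , b∈Q , to-a≡to-b ← ∈-map⁻ to v∈Q =
    disjoint a a∈P (subst (_∈ Q) (sym (to-injective ι to-a≡to-b)) b∈Q)

  graphIso⇒packingTransfer : PackingTransfer G S
  graphIso⇒packingTransfer = map-transfer G S (map to) isMaxGeodesic-map disjoint-map

Iso⇒packingEquivalent : ∀ {n m} {G : Graph n} {S : Graph m} → Iso G S → PackingEquivalent G S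
Iso⇒packingEquivalent {G = G} {S} iso =
  graphIso⇒packingTransfer ι , graphIso⇒packingTransfer (graphIso-sym ι)
  where
  ι : GraphIso G S
  ι = Iso⇒GraphIso iso

module Smoothing {n : ℕ} (G : Graph (suc n)) (H : Graph n) (u x y : Fin (suc n))
  (degree2 : Degree2With G u x y)
  (adj⇔ : ∀ a b → Adj H a b ⇔ (Adj G (punchIn u a) (punchIn u b)
                                ⊎ (punchIn u a ≡ x × punchIn u b ≡ y)
                                ⊎ (punchIn u a ≡ y × punchIn u b ≡ x)))
  (uniqG : UniquePaths G) where

  open import Data.List.Membership.DecPropositional (_≟F_ {n}) using (_∈?_)

  x≢y : x ≢ y
  x≢y = proj₁ degree2

  u-x : Adj G u x
  u-x = proj₁ (proj₂ degree2)

  u-y : Adj G u y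
  u-y = proj₁ (proj₂ (proj₂ degree2))

  u-neighbours : ∀ w → Adj G u w → w ≡ x ⊎ w ≡ y
  u-neighbours = proj₂ (proj₂ (proj₂ degree2))

  φ : Fin n → Fin (suc n)
  φ = punchIn u

  φ≢u : ∀ a → φ a ≢ u
  φ≢u = punchInᵢ≢i u

  φ-injective : ∀ {a b} → φ a ≡ φ b → a ≡ b
  φ-injective = punchIn-injective u _ _

  φ-surjective : ∀ v → v ≢ u → ∃ λ a → φ a ≡ v
  φ-surjective v v≢u = punchOut (v≢u ∘ sym) , punchIn-punchOut (v≢u ∘ sym)

  adj-u⇒≢u : ∀ {v} → Adj G u v → v ≢ u
  adj-u⇒≢u r refl = adj-irrefl G r

  x′ : Fin n
  x′ = proj₁ (φ-surjective x (adj-u⇒≢u u-x))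

  φx′≡x : φ x′ ≡ x
  φx′≡x = proj₂ (φ-surjective x (adj-u⇒≢u u-x))

  y′ : Fin n
  y′ = proj₁ (φ-surjective y (adj-u⇒≢u u-y))

  φy′≡y : φ y′ ≡ y
  φy′≡y = proj₂ (φ-surjective y (adj-u⇒≢u u-y))

  NewEdge : Fin n → Fin n → Set
  NewEdge a b = (φ a ≡ x × φ b ≡ y) ⊎ (φ a ≡ y × φ b ≡ x)

  newEdge? : ∀ a b → Dec (NewEdge a b)
  newEdge? a b = ((φ a ≟F x) ×-dec (φ b ≟F y)) ⊎-dec ((φ a ≟F y) ×-dec (φ b ≟F x))

  newEdge-sym : ∀ {a b} → NewEdge a b → NewEdge b a
  newEdge-sym (inj₁ (ax , by)) = inj₂ (by , ax)
  newEdge-sym (inj₂ (ay , bx)) = inj₁ (bx , ay)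

  adjH⇒ : ∀ {a b} → Adj H a b → Adj G (φ a) (φ b) ⊎ NewEdge a b
  adjH⇒ {a} {b} = Equivalence.to (adj⇔ a b)

  adjG⇒adjH : ∀ {a b} → Adj G (φ a) (φ b) → Adj H a b
  adjG⇒adjH {a} {b} r = Equivalence.from (adj⇔ a b) (inj₁ r)

  newEdge⇒adjH : ∀ {a b} → NewEdge a b → Adj H a b
  newEdge⇒adjH {a} {b} e = Equivalence.from (adj⇔ a b) (inj₂ e)

  newEdge⇒adjˡ : ∀ {a b} → NewEdge a b → Adj G (φ a) u
  newEdge⇒adjˡ (inj₁ (refl , _)) = adj-sym G u-x
  newEdge⇒adjˡ (inj₂ (refl , _)) = adj-sym G u-y

  newEdge⇒adjʳ : ∀ {a b} → NewEdge a b → Adj G u (φ b)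
  newEdge⇒adjʳ e = adj-sym G (newEdge⇒adjˡ (newEdge-sym e))

  adj-u⇒newEdge : ∀ a → Adj G (φ a) u → ∃ λ b → NewEdge a b
  adj-u⇒newEdge a r with u-neighbours (φ a) (adj-sym G r)
  ... | inj₁ φa≡x = y′ , inj₁ (φa≡x , φy′≡y)
  ... | inj₂ φa≡y = x′ , inj₂ (φa≡y , φx′≡x)

  newEdge-u-neighbours : ∀ {a b} → NewEdge a b → ∀ w → Adj G u w → w ≡ φ a ⊎ w ≡ φ b
  newEdge-u-neighbours (inj₁ (ax , by)) w r with u-neighbours w r
  ... | inj₁ refl = inj₁ (sym ax)
  ... | inj₂ refl = inj₂ (sym by)
  newEdge-u-neighbours (inj₂ (ay , bx)) w r with u-neighbours w r
  ... | inj₁ refl = inj₂ (sym bx)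
  ... | inj₂ refl = inj₁ (sym ay)

  distinct-u-neighbours⇒newEdge : ∀ a c → Adj G u (φ a) → Adj G u (φ c) → φ a ≢ φ c → NewEdge a c
  distinct-u-neighbours⇒newEdge a c ua uc φa≢φc with u-neighbours (φ a) ua | u-neighbours (φ c) uc
  ... | inj₁ ax | inj₁ cx = ⊥-elim (φa≢φc (trans ax (sym cx)))
  ... | inj₁ ax | inj₂ cy = inj₁ (ax , cy)
  ... | inj₂ ay | inj₁ cx = inj₂ (ay , cx)
  ... | inj₂ ay | inj₂ cy = ⊥-elim (φa≢φc (trans ay (sym cy)))

  del : List (Fin (suc n)) → List (Fin n)
  del []      = []
  del (v ∷ r) with u ≟F v
  ... | yes _   = del r
  ... | no u≢v = punchOut u≢v ∷ del r

  del-φ∷ : ∀ a r → del (φ a ∷ r) ≡ a ∷ del r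
  del-φ∷ a r with u ≟F φ a
  ... | yes u≡φa = ⊥-elim (φ≢u a (sym u≡φa))
  ... | no _     = cong (_∷ del r) (trans (punchOut-cong u refl) (punchOut-punchIn u))

  del-u∷ : ∀ r → del (u ∷ r) ≡ del r
  del-u∷ r with u ≟F u
  ... | yes _   = refl
  ... | no u≢u = ⊥-elim (u≢u refl)

  del-++ : ∀ xs ys → del (xs ++ ys) ≡ del xs ++ del ys
  del-++ []       ys = refl
  del-++ (v ∷ xs) ys with u ≟F v
  ... | yes _ = del-++ xs ys
  ... | no _  = cong (_ ∷_) (del-++ xs ys)

  ∈-del⁻ : ∀ {a} P → a ∈ del P → φ a ∈ P
  ∈-del⁻ (v ∷ r) a∈ with u ≟F v
  ∈-del⁻ (v ∷ r) a∈          | yes _   = there (∈-del⁻ r a∈)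
  ∈-del⁻ (v ∷ r) (here refl)  | no u≢v = here (punchIn-punchOut u≢v)
  ∈-del⁻ (v ∷ r) (there a∈)   | no _    = there (∈-del⁻ r a∈)

  ∈-del⁺ : ∀ {a} P → φ a ∈ P → a ∈ del P
  ∈-del⁺ {a} (v ∷ r) φa∈ with u ≟F v
  ∈-del⁺ {a} (v ∷ r) (here φa≡u) | yes refl = ⊥-elim (φ≢u a φa≡u)
  ∈-del⁺ {a} (v ∷ r) (there φa∈) | yes refl = ∈-del⁺ r φa∈
  ∈-del⁺ {a} (v ∷ r) (here φa≡v) | no u≢v  = here (φ-injective (trans φa≡v (sym (punchIn-punchOut u≢v))))
  ∈-del⁺ {a} (v ∷ r) (there φa∈) | no _     = there (∈-del⁺ r φa∈)

  unique-del : ∀ P → Unique P → Unique (del P)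
  unique-del []      _          = []
  unique-del (v ∷ r) (v∉ ∷ un) with u ≟F v
  ... | yes _   = unique-del r un
  ... | no u≢v = tabulate (λ a∈ e → lookup v∉ (∈-del⁻ r a∈) (trans (sym (punchIn-punchOut u≢v)) (cong φ e)))
                 ∷ unique-del r un

  -- Where the path passes through u, its neighbours on the path are x and y, joined in H by the new edge.
  linked-del : ∀ a r → Linked (Adj G) (φ a ∷ r) → Unique (φ a ∷ r) → last (φ a ∷ r) ≢ just u →
               Linked (Adj H) (a ∷ del r)
  linked-del a [] _ _ _ = [-]
  linked-del a (v ∷ r) l un last≢u with v ≟F u
  linked-del a (v ∷ []) _ _ last≢u | yes refl = ⊥-elim (last≢u refl)
  linked-del a (v ∷ w ∷ r) (r₁ ∷ r₂ ∷ l) (φa∉ ∷ u∉ ∷ un) last≢u | yes refl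
    with c , refl ← φ-surjective w (λ w≡u → lookup u∉ (here refl) (sym w≡u))
    rewrite del-u∷ (φ c ∷ r) | del-φ∷ c r =
    newEdge⇒adjH (distinct-u-neighbours⇒newEdge a c (adj-sym G r₁) r₂ (lookup φa∉ (there (here refl))))
    ∷ linked-del c r l un last≢u
  linked-del a (v ∷ r) (r₁ ∷ l) (_ ∷ un) last≢u | no v≢u
    with c , refl ← φ-surjective v v≢u rewrite del-φ∷ c r =
    adjG⇒adjH r₁ ∷ linked-del c r l un last≢u

  isPath-del : ∀ a r → IsPath G (φ a ∷ r) → last (φ a ∷ r) ≢ just u → IsPath H (del (φ a ∷ r))
  isPath-del a r (l , un , _) last≢u = subst (IsPath H) (sym (del-φ∷ a r))
    (linked-del a r l un last≢u , subst Unique (del-φ∷ a r) (unique-del (φ a ∷ r) un) , (λ ()))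

  last-del : ∀ P c → last P ≡ just (φ c) → last (del P) ≡ just c
  last-del P c last≡ with xs , refl ← last≡just⇒∷ʳ P last≡ rewrite del-++ xs (φ c ∷ []) | del-φ∷ c [] =
    last-∷ʳ (del xs) c

  -- ins' a l re-inserts u between consecutive vertices joined by the new edge; a is the vertex preceding l.
  ins' : Fin n → List (Fin n) → List (Fin (suc n))
  ins' a []      = []
  ins' a (b ∷ l) with newEdge? a b
  ... | yes _ = u ∷ φ b ∷ ins' b l
  ... | no _  = φ b ∷ ins' b l

  ins : List (Fin n) → List (Fin (suc n))
  ins []      = []
  ins (a ∷ l) = φ a ∷ ins' a l

  del-ins' : ∀ a l → del (ins' a l) ≡ l
  del-ins' a []      = refl
  del-ins' a (b ∷ l) with newEdge? a b
  ... | yes _ = trans (del-u∷ (φ b ∷ ins' b l)) (trans (del-φ∷ b (ins' b l)) (cong (b ∷_) (del-ins' b l)))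
  ... | no _  = trans (del-φ∷ b (ins' b l)) (cong (b ∷_) (del-ins' b l))

  del-ins : ∀ P → del (ins P) ≡ P
  del-ins []      = refl
  del-ins (a ∷ l) = trans (del-φ∷ a (ins' a l)) (cong (a ∷_) (del-ins' a l))

  _∈φ_ : Fin (suc n) → List (Fin n) → Set
  v ∈φ l = ∃ λ c → c ∈ l × v ≡ φ c

  ∈φ-there : ∀ {v b l} → v ∈φ l → v ∈φ (b ∷ l)
  ∈φ-there (c , c∈ , v≡φc) = c , there c∈ , v≡φc

  ∈-ins'⁻ : ∀ {v} a l → v ∈ ins' a l → v ≡ u ⊎ v ∈φ l
  ∈-ins'⁻ a (b ∷ l) v∈ with newEdge? a b
  ∈-ins'⁻ a (b ∷ l) (here v≡u)          | yes _ = inj₁ v≡u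
  ∈-ins'⁻ a (b ∷ l) (there (here v≡φb)) | yes _ = inj₂ (b , here refl , v≡φb)
  ∈-ins'⁻ a (b ∷ l) (there (there v∈))  | yes _ = map₂ ∈φ-there (∈-ins'⁻ b l v∈)
  ∈-ins'⁻ a (b ∷ l) (here v≡φb)         | no _  = inj₂ (b , here refl , v≡φb)
  ∈-ins'⁻ a (b ∷ l) (there v∈)          | no _  = map₂ ∈φ-there (∈-ins'⁻ b l v∈)

  ∈-ins⁻ : ∀ {v} P → v ∈ ins P → v ≡ u ⊎ v ∈φ P
  ∈-ins⁻ (a ∷ l) (here v≡φa) = inj₂ (a , here refl , v≡φa)
  ∈-ins⁻ (a ∷ l) (there v∈)  = map₂ ∈φ-there (∈-ins'⁻ a l v∈)

  φ∉ins' : ∀ {c} b l → c ∉ l → φ c ∉ ins' b l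
  φ∉ins' {c} b l c∉l φc∈ with ∈-ins'⁻ b l φc∈
  ... | inj₁ φc≡u             = φ≢u c φc≡u
  ... | inj₂ (c′ , c′∈ , φc≡) = c∉l (subst (_∈ l) (sym (φ-injective φc≡)) c′∈)

  ∈-ins'⁺ : ∀ {c} a l → c ∈ l → φ c ∈ ins' a l
  ∈-ins'⁺ a (b ∷ l) c∈ with newEdge? a b
  ∈-ins'⁺ a (b ∷ l) (here refl) | yes _ = there (here refl)
  ∈-ins'⁺ a (b ∷ l) (there c∈)  | yes _ = there (there (∈-ins'⁺ b l c∈))
  ∈-ins'⁺ a (b ∷ l) (here refl) | no _  = here refl
  ∈-ins'⁺ a (b ∷ l) (there c∈)  | no _  = there (∈-ins'⁺ b l c∈)

  ∈-ins⁺ : ∀ {c} P → c ∈ P → φ c ∈ ins P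
  ∈-ins⁺ (a ∷ l) (here refl) = here refl
  ∈-ins⁺ (a ∷ l) (there c∈)  = there (∈-ins'⁺ a l c∈)

  ins'-∷ : ∀ {v} a b l → v ∈ ins' b l → v ∈ ins' a (b ∷ l)
  ins'-∷ a b l v∈ with newEdge? a b
  ... | yes _ = there (there v∈)
  ... | no _  = there v∈

  u∈ins'-∷ : ∀ a b l → NewEdge a b → u ∈ ins' a (b ∷ l)
  u∈ins'-∷ a b l e with newEdge? a b
  ... | yes _  = here refl
  ... | no ¬e = ⊥-elim (¬e e)

  u∈ins' : ∀ c A a b B → NewEdge a b → u ∈ ins' c (A ++ a ∷ b ∷ B)
  u∈ins' c []      a b B e = ins'-∷ c a (b ∷ B) (u∈ins'-∷ a b B e)
  u∈ins' c (d ∷ A) a b B e = ins'-∷ c d (A ++ a ∷ b ∷ B) (u∈ins' d A a b B e)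

  u∈ins : ∀ A a b B → NewEdge a b → u ∈ ins (A ++ a ∷ b ∷ B)
  u∈ins []      a b B e = there (u∈ins'-∷ a b B e)
  u∈ins (c ∷ A) a b B e = there (u∈ins' c A a b B e)

  newEdge-covers : ∀ {a b c} → NewEdge a b → φ c ≡ x ⊎ φ c ≡ y → c ∈ a ∷ b ∷ []
  newEdge-covers (inj₁ (ax , by)) (inj₁ cx) = here (φ-injective (trans cx (sym ax)))
  newEdge-covers (inj₁ (ax , by)) (inj₂ cy) = there (here (φ-injective (trans cy (sym by))))
  newEdge-covers (inj₂ (ay , bx)) (inj₁ cx) = there (here (φ-injective (trans cx (sym bx))))
  newEdge-covers (inj₂ (ay , bx)) (inj₂ cy) = here (φ-injective (trans cy (sym ay)))

  newEdge-flank : ∀ {a b} → NewEdge a b → φ a ≡ x ⊎ φ a ≡ y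
  newEdge-flank (inj₁ (ax , _)) = inj₁ ax
  newEdge-flank (inj₂ (ay , _)) = inj₂ ay

  u∈ins'⇒∈ : ∀ {c} a l → φ c ≡ x ⊎ φ c ≡ y → u ∈ ins' a l → c ∈ a ∷ l
  u∈ins'⇒∈ a (b ∷ l) flank u∈ with newEdge? a b
  u∈ins'⇒∈ a (b ∷ l) flank u∈             | yes e with newEdge-covers e flank
  ... | here c≡a          = here c≡a
  ... | there (here c≡b)  = there (here c≡b)
  u∈ins'⇒∈ a (b ∷ l) flank (here u≡φb)    | no _ = ⊥-elim (φ≢u b (sym u≡φb))
  u∈ins'⇒∈ a (b ∷ l) flank (there u∈)     | no _ = there (u∈ins'⇒∈ b l flank u∈)

  u∈ins⇒x′∈ : ∀ P → u ∈ ins P → x′ ∈ P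
  u∈ins⇒x′∈ (a ∷ l) (here u≡φa) = ⊥-elim (φ≢u a (sym u≡φa))
  u∈ins⇒x′∈ (a ∷ l) (there u∈)  = u∈ins'⇒∈ a l (inj₁ φx′≡x) u∈

  linked-ins' : ∀ a l → Linked (Adj H) (a ∷ l) → Linked (Adj G) (φ a ∷ ins' a l)
  linked-ins' a []      _        = [-]
  linked-ins' a (b ∷ l) (r ∷ lk) with newEdge? a b
  ... | yes e  = newEdge⇒adjˡ e ∷ newEdge⇒adjʳ e ∷ linked-ins' b l lk
  ... | no ¬e with adjH⇒ r
  ...   | inj₁ r′ = r′ ∷ linked-ins' b l lk
  ...   | inj₂ e  = ⊥-elim (¬e e)

  unique-ins' : ∀ a l → Unique (a ∷ l) → Unique (ins' a l)
  unique-ins  : ∀ a l → Unique (a ∷ l) → Unique (φ a ∷ ins' a l)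

  unique-ins' a []      _          = []
  unique-ins' a (b ∷ l) (a∉ ∷ un) with newEdge? a b
  ... | yes e = All.¬Any⇒All¬ (φ b ∷ ins' b l) u∉ ∷ unique-ins b l un
    where
    u∉ : u ∉ φ b ∷ ins' b l
    u∉ (here u≡φb) = φ≢u b (sym u≡φb)
    u∉ (there u∈)  = All.All¬⇒¬Any a∉ (u∈ins'⇒∈ b l (newEdge-flank e) u∈)
  ... | no _  = unique-ins b l un

  unique-ins a l un@(a∉ ∷ _) = All.¬Any⇒All¬ (ins' a l) (φ∉ins' a l (All.All¬⇒¬Any a∉)) ∷ unique-ins' a l un

  isPath-ins : ∀ P → IsPath H P → IsPath G (ins P)
  isPath-ins []      (_ , _ , []≢[]) = ⊥-elim ([]≢[] refl)
  isPath-ins (a ∷ l) (lk , un , _)   = linked-ins' a l lk , unique-ins a l un , (λ ())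

  head-ins : ∀ P → head (ins P) ≡ Maybe.map φ (head P)
  head-ins []      = refl
  head-ins (a ∷ l) = refl

  last-ins' : ∀ a l → last (φ a ∷ ins' a l) ≡ Maybe.map φ (last (a ∷ l))
  last-ins' a []      = refl
  last-ins' a (b ∷ l) with newEdge? a b
  ... | yes _ = last-ins' b l
  ... | no _  = last-ins' b l

  last-ins : ∀ P → last (ins P) ≡ Maybe.map φ (last P)
  last-ins []      = refl
  last-ins (a ∷ l) = last-ins' a l

  -- ins is a section of del that maps paths of H to paths of G with the same ends (up to φ).
  uniqH : UniquePaths H
  uniqH P Q p q same-head same-last = begin
    P             ≡⟨ del-ins P ⟨
    del (ins P)   ≡⟨ cong del (uniqG (ins P) (ins Q) (isPath-ins P p) (isPath-ins Q q)
                       (trans (head-ins P) (trans (cong (Maybe.map φ) same-head) (sym (head-ins Q))))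
                       (trans (last-ins P) (trans (cong (Maybe.map φ) same-last) (sym (last-ins Q))))) ⟩
    del (ins Q)   ≡⟨ del-ins Q ⟩
    Q             ∎
    where open ≡-Reasoning

  last-del⁻ : ∀ P b → P ≢ [] → last P ≢ just u → last (del P) ≡ just b → last P ≡ just (φ b)
  last-del⁻ P b P≢[] last≢u last≡b with ∃last P P≢[]
  ... | w , last≡w with φ-surjective w (λ w≡u → last≢u (trans last≡w (cong just w≡u)))
  ...   | c , refl with trans (sym (last-del P c last≡w)) last≡b
  ...     | refl = last≡w

  module UG = WithUniquePaths G uniqG
  module UH = WithUniquePaths H uniqH

  -- An end at u would force both x and y to be the second vertex.
  head≢u : ∀ P → NonExtendable G P → head P ≢ just u
  head≢u (v ∷ r) (path , head-closed , _) refl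
    with rest₁ , r≡x∷ ← UG.adj-head⇒second u r x path (head-closed u x refl u-x) u-x
       | rest₂ , r≡y∷ ← UG.adj-head⇒second u r y path (head-closed u y refl u-y) u-y
    = x≢y (∷-injectiveˡ (trans (sym r≡x∷) r≡y∷))

  last≢u : ∀ P → NonExtendable G P → last P ≢ just u
  last≢u P (path , _ , last-closed) last≡u
    with pre₁ , P≡x∷u ← UG.adj-last⇒penultimate P u x path last≡u (last-closed u x last≡u u-x) u-x
       | pre₂ , P≡y∷u ← UG.adj-last⇒penultimate P u y path last≡u (last-closed u y last≡u u-y) u-y
    = x≢y (∷ʳ-∷ʳ-injectiveʳ pre₁ pre₂ (trans (sym P≡x∷u) P≡y∷u))

  -- The vertex after φ a must be u, and the one after u the other neighbour of u.
  head-newEdge⇒∈ : ∀ {a b} P → NewEdge a b → IsPath G P → head P ≡ just (φ a) →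
                   (∀ z → Adj G (φ a) z → z ∈ P) → last P ≢ just u → φ b ∈ P
  head-newEdge⇒∈ {a} (_ ∷ r) e path refl closed last≢u
    with UG.adj-head⇒second (φ a) r u path (closed u (newEdge⇒adjˡ e)) (newEdge⇒adjˡ e)
  ... | []       , refl = ⊥-elim (last≢u refl)
  ... | w ∷ rest , refl with newEdge-u-neighbours e w (Linked.head (Linked.tail (proj₁ path)))
  ...   | inj₁ refl = ⊥-elim (Unique[x∷xs]⇒x∉xs (proj₁ (proj₂ path)) (there (here refl)))
  ...   | inj₂ refl = there (there (here refl))

  last-newEdge⇒∈ : ∀ {a b} P → NewEdge a b → IsPath G P → last P ≡ just (φ a) →
                   (∀ z → Adj G (φ a) z → z ∈ P) → head P ≢ just u → φ b ∈ P
  last-newEdge⇒∈ {a} P e path last≡ closed head≢u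
    with UG.adj-last⇒penultimate P (φ a) u path last≡ (closed u (newEdge⇒adjˡ e)) (newEdge⇒adjˡ e)
  ... | []      , refl = ⊥-elim (head≢u refl)
  ... | c ∷ pre , refl with ∃last (c ∷ pre) (λ ())
  ...   | w , last≡w with newEdge-u-neighbours e w (adj-sym G (linked-junction (c ∷ pre) (proj₁ path) last≡w))
  ...     | inj₁ refl =
    ⊥-elim (unique-++⇒∉ (c ∷ pre) (proj₁ (proj₂ path)) (last⇒∈ (c ∷ pre) last≡w) (there (here refl)))
  ...     | inj₂ refl = ∈-++⁺ˡ (last⇒∈ (c ∷ pre) last≡w)

  closed-del : ∀ P b → (∀ z → Adj G (φ b) z → z ∈ P) → (∀ {c} → NewEdge b c → φ c ∈ P) →
               ∀ z → Adj H b z → z ∈ del P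
  closed-del P b closed through z bz with adjH⇒ bz
  ... | inj₁ r = ∈-del⁺ P (closed (φ z) r)
  ... | inj₂ e = ∈-del⁺ P (through e)

  nonExtendable-del : ∀ P → NonExtendable G P → NonExtendable H (del P)
  nonExtendable-del []      ((_ , _ , []≢[]) , _) = ⊥-elim ([]≢[] refl)
  nonExtendable-del (v ∷ r) ne@(path , head-closed , last-closed)
    with a , refl ← φ-surjective v (λ v≡u → head≢u (v ∷ r) ne (cong just v≡u)) =
    isPath-del a r path (last≢u P ne) , head-closedH , last-closedH
    where
    P = φ a ∷ r

    head-closedH : ∀ b z → head (del P) ≡ just b → Adj H b z → z ∈ del P
    head-closedH b z head≡b with refl ← trans (sym (cong head (del-φ∷ a r))) head≡b =
      closed-del P a closed (λ e → head-newEdge⇒∈ P e path refl closed (last≢u P ne)) z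
      where
      closed : ∀ z → Adj G (φ a) z → z ∈ P
      closed z = head-closed (φ a) z refl

    last-closedH : ∀ b z → last (del P) ≡ just b → Adj H b z → z ∈ del P
    last-closedH b z last≡b =
      closed-del P b closed (λ e → last-newEdge⇒∈ P e path last≡φb closed (head≢u P ne)) z
      where
      last≡φb : last P ≡ just (φ b)
      last≡φb = last-del⁻ P b (λ ()) (last≢u P ne) last≡b
      closed : ∀ z → Adj G (φ b) z → z ∈ P
      closed z = last-closed (φ b) z last≡φb

  closed-ins : ∀ P b → (∀ z → Adj H b z → z ∈ P) → (Adj G (φ b) u → u ∈ ins P) →
               ∀ z → Adj G (φ b) z → z ∈ ins P
  closed-ins P b closed via-u z bz with z ≟F u
  ... | yes refl = via-u bz
  ... | no z≢u with z′ , refl ← φ-surjective z z≢u = ∈-ins⁺ P (closed z′ (adjG⇒adjH bz))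

  nonExtendable-ins : ∀ P → NonExtendable H P → NonExtendable G (ins P)
  nonExtendable-ins []      ((_ , _ , []≢[]) , _) = ⊥-elim ([]≢[] refl)
  nonExtendable-ins (a ∷ l) (path , head-closed , last-closed) = isPath-ins P path , head-closedG , last-closedG
    where
    P = a ∷ l

    head-via-u : Adj G (φ a) u → u ∈ ins P
    head-via-u r with adj-u⇒newEdge a r
    ... | c , e with UH.adj-head⇒second a l c path (head-closed a c refl (newEdge⇒adjH e)) (newEdge⇒adjH e)
    ...   | rest , refl = u∈ins [] a c rest e

    head-closedG : ∀ b z → head (ins P) ≡ just b → Adj G b z → z ∈ ins P
    head-closedG _ z refl = closed-ins P a (λ z → head-closed a z refl) head-via-u z

    last-closedG : ∀ b z → last (ins P) ≡ just b → Adj G b z → z ∈ ins P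
    last-closedG b z last≡b with ∃last P (λ ())
    ... | c , last≡c with refl ← trans (sym last≡b) (trans (last-ins P) (cong (Maybe.map φ) last≡c)) =
      closed-ins P c (λ z → last-closed c z last≡c) last-via-u z
      where
      last-via-u : Adj G (φ c) u → u ∈ ins P
      last-via-u r with adj-u⇒newEdge c r
      ... | d , e with UH.adj-last⇒penultimate P c d path last≡c (last-closed c d last≡c (newEdge⇒adjH e)) (newEdge⇒adjH e)
      ...   | pre , P≡ = subst (λ Q → u ∈ ins Q) (sym P≡) (u∈ins pre d c [] (newEdge-sym e))

  disjoint-del : ∀ P Q → Disjoint G P Q → Disjoint H (del P) (del Q)
  disjoint-del P Q disjoint a a∈P a∈Q = disjoint (φ a) (∈-del⁻ P a∈P) (∈-del⁻ Q a∈Q)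

  disjoint-ins : ∀ P Q → Disjoint H P Q → Disjoint G (ins P) (ins Q)
  disjoint-ins P Q disjoint v v∈P v∈Q with ∈-ins⁻ P v∈P | ∈-ins⁻ Q v∈Q
  ... | inj₁ refl                | _              = disjoint x′ (u∈ins⇒x′∈ P v∈P) (u∈ins⇒x′∈ Q v∈Q)
  ... | inj₂ (c , c∈P , refl)   | inj₁ φc≡u     = φ≢u c φc≡u
  ... | inj₂ (c , c∈P , refl)   | inj₂ (c′ , c′∈Q , φc≡φc′) =
    disjoint c c∈P (subst (_∈ Q) (sym (φ-injective φc≡φc′)) c′∈Q)

  maxGeodesic-del : ∀ P → IsMaxGeodesic G P → IsMaxGeodesic H (del P)
  maxGeodesic-del P = UH.nonExtendable⇒maxGeodesic (del P) ∘ nonExtendable-del P ∘ UG.maxGeodesic⇒nonExtendable P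

  maxGeodesic-ins : ∀ P → IsMaxGeodesic H P → IsMaxGeodesic G (ins P)
  maxGeodesic-ins P = UG.nonExtendable⇒maxGeodesic (ins P) ∘ nonExtendable-ins P ∘ UH.maxGeodesic⇒nonExtendable P

  packingEquivalent : PackingEquivalent G H
  packingEquivalent = map-transfer G H del maxGeodesic-del disjoint-del , map-transfer H G ins maxGeodesic-ins disjoint-ins

smoothings⇒packingEquivalent : ∀ {n m} {G : Graph n} {K : Graph m} → UniquePaths G → Smoothings G K →
                               PackingEquivalent G K
smoothings⇒packingEquivalent uniq (done G) = packingEquivalent-refl {G = G}
smoothings⇒packingEquivalent {G = G} {K} uniq (step {H = H} (u , x , y , degree2 , adj⇔) smoothings) =
  packingEquivalent-trans {G = G} {H} {K} (Smoothing.packingEquivalent G H u x y degree2 adj⇔ uniq)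
    (smoothings⇒packingEquivalent (Smoothing.uniqH G H u x y degree2 adj⇔ uniq) smoothings)

lemma3p1 : ∀ {n m} (T : Graph n) (S : Graph m) → IsTree T → IsSM T S →
           ∀ k → IsGpack T k ⇔ IsGpack S k
lemma3p1 T S (_ , acyclic) (_ , H , smoothings , _ , iso) =
  packingEquivalent⇒gpack-⇔ T S
    (packingEquivalent-trans {G = T} {H} {S}
      (smoothings⇒packingEquivalent (acyclic⇒uniquePaths T acyclic) smoothings)
      (Iso⇒packingEquivalent {G = H} {S} iso))
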